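{- Let $\mathcal{A}=\langle A,*,\neg_r,\neg_l,0,1,\le\rangle$ be such that $\langle A,*,1,\le\rangle$ is a partially ordered monoid, $\neg_r,\neg_l$ are unary operations on $A$ and $0\in A$. The following are equivalent: (i) for all $a,b\in A$: $a*b\le 0$ iff $b\le\neg_r a$ iff $a\le\neg_l b$; (ii) the operations $\neg_r$ and $\neg_l$ are antimonotone (i.e. $a\le b$ implies $\neg_r b\le\neg_r a$ and $\neg_l b\le\neg_l a$), and for all $x,y\in A$: $\neg_r 1\le 0$, $1\le\neg_r 0$, $x*\neg_r(y*x)\le\neg_r y$, $\neg_l 1\le 0$, $1\le\neg_l 0$, and $\neg_l(x*y)*x\le\neg_l y$.
   Context: A partially ordered monoid is a structure $\langle A,*,1,\le\rangle$ where $\langle A,*,1\rangle$ is a monoid, $\le$ is a partial order on $A$, and $*$ is monotone in both arguments ($a\le c$ and $b\le d$ imply $a*b\le c*d$). -}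

module Defs where

open import Level using (Level; suc; _⊔_)
open import Algebra.Bundles using (Monoid)
open import Relation.Binary.Core using (Rel)
open import Relation.Binary.Structures using (IsPartialOrder)

record Pomonoid (c ℓ₁ ℓ₂ : Level) : Set (suc (c ⊔ ℓ₁ ⊔ ℓ₂)) where
  field
    monoid         : Monoid c ℓ₁
  open Monoid monoid public
  field
    _≤_            : Rel Carrier ℓ₂
    isPartialOrder : IsPartialOrder _≈_ _≤_
    mono           : ∀ {a b c d} → a ≤ c → b ≤ d → (a ∙ b) ≤ (c ∙ d)

-- Each of the two conditions in (i) is a Galois-type correspondence on its own:
-- a ∙ b ≤ 0 ⇔ b ≤ ¬r a is equivalent to the four ¬r-axioms of (ii), since
-- antitonicity and the unit axioms give b ≈ b ∙ ε ≤ b ∙ ¬r 0 ≤ b ∙ ¬r (a ∙ b) ≤ ¬r a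
-- and a ∙ ¬r a ≤ a ∙ ¬r (ε ∙ a) ≤ ¬r ε ≤ 0.  The ¬l-half is the same statement
-- in the opposite monoid, and (i) is just the conjunction of the two halves.
module Submission where

open import Defs
open import Level using (Level)
open import Data.Product using (_×_; _,_; proj₁; proj₂)
open import Function.Base using (flip)
open import Function.Bundles using (_⇔_; mk⇔; Equivalence)
import Function.Properties.Equivalence as ⇔
open import Data.Product.Function.NonDependent.Propositional using (_×-⇔_)
import Algebra.Construct.Flip.Op as Op
open import Relation.Binary.Structures using (IsPartialOrder)

opposite : ∀ {c ℓ₁ ℓ₂} → Pomonoid c ℓ₁ ℓ₂ → Pomonoid c ℓ₁ ℓ₂
opposite P = record
  { monoid         = Op.monoid monoid
  ; _≤_            = _≤_
  ; isPartialOrder = isPartialOrder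
  ; mono           = flip mono
  }
  where open Pomonoid P

module _ {c ℓ₁ ℓ₂ : Level} (P : Pomonoid c ℓ₁ ℓ₂) where
  open Pomonoid P
  open IsPartialOrder isPartialOrder using ()
    renaming (refl to ≤-refl; reflexive to ≤-reflexive; trans to ≤-trans)

  Antitone : (Carrier → Carrier) → Set _
  Antitone f = ∀ {a b} → a ≤ b → f b ≤ f a

  RightResidual : (Carrier → Carrier) → Carrier → Set _
  RightResidual ¬r o = ∀ a b → ((a ∙ b) ≤ o) ⇔ (b ≤ ¬r a)

  RightNegationAxioms : (Carrier → Carrier) → Carrier → Set _
  RightNegationAxioms ¬r o =
    Antitone ¬r × (¬r ε ≤ o) × (ε ≤ ¬r o) × (∀ x y → (x ∙ ¬r (y ∙ x)) ≤ ¬r y)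

  module _ {¬r : Carrier → Carrier} {o : Carrier} where

    rightResidual⇒axioms : RightResidual ¬r o → RightNegationAxioms ¬r o
    rightResidual⇒axioms res =
        (λ a≤b → toRes (≤-trans (mono a≤b ≤-refl) counit))
      , ≤-trans (≤-reflexive (sym (identityˡ _))) counit
      , toRes (≤-reflexive (identityʳ o))
      , (λ x y → toRes (≤-trans (≤-reflexive (sym (assoc _ _ _))) counit))
      where
      toRes : ∀ {a b} → (a ∙ b) ≤ o → b ≤ ¬r a
      toRes {a} {b} = Equivalence.to (res a b)
      counit : ∀ {a} → (a ∙ ¬r a) ≤ o
      counit {a} = Equivalence.from (res a (¬r a)) ≤-refl

    axioms⇒rightResidual : RightNegationAxioms ¬r o → RightResidual ¬r o
    axioms⇒rightResidual (anti , ¬ε≤o , ε≤¬o , shift) a b = mk⇔ toRes fromRes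
      where
      toRes : (a ∙ b) ≤ o → b ≤ ¬r a
      toRes ab≤o = ≤-trans (≤-reflexive (sym (identityʳ b)))
        (≤-trans (mono ≤-refl (≤-trans ε≤¬o (anti ab≤o))) (shift b a))
      fromRes : b ≤ ¬r a → (a ∙ b) ≤ o
      fromRes b≤¬a = ≤-trans (mono ≤-refl b≤¬a)
        (≤-trans (mono ≤-refl (anti (≤-reflexive (identityˡ a))))
          (≤-trans (shift a ε) ¬ε≤o))

    rightResidual⇔axioms : RightResidual ¬r o ⇔ RightNegationAxioms ¬r o
    rightResidual⇔axioms = mk⇔ rightResidual⇒axioms axioms⇒rightResidual

module _ {c ℓ₁ ℓ₂ : Level} (P : Pomonoid c ℓ₁ ℓ₂) where
  open Pomonoid P using (Carrier; _∙_; _≤_)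

  LeftResidual : (Carrier → Carrier) → Carrier → Set _
  LeftResidual ¬l o = ∀ a b → ((a ∙ b) ≤ o) ⇔ (a ≤ ¬l b)

  -- In the opposite monoid x ∙ ¬l (y ∙ x) reads ¬l (x ∙ y) ∙ x.
  LeftNegationAxioms : (Carrier → Carrier) → Carrier → Set _
  LeftNegationAxioms = RightNegationAxioms (opposite P)

  leftResidual⇔axioms : ∀ {¬l o} → LeftResidual ¬l o ⇔ LeftNegationAxioms ¬l o
  leftResidual⇔axioms = mk⇔
    (λ res → rightResidual⇒axioms (opposite P) (flip res))
    (λ axioms → flip (axioms⇒rightResidual (opposite P) axioms))

  residualChain⇔bothResiduals : ∀ {¬r ¬l o} →
    (∀ a b → (((a ∙ b) ≤ o) ⇔ (b ≤ ¬r a)) × ((b ≤ ¬r a) ⇔ (a ≤ ¬l b)))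
    ⇔ (RightResidual P ¬r o × LeftResidual ¬l o)
  residualChain⇔bothResiduals = mk⇔
    (λ chain → (λ a b → proj₁ (chain a b))
             , (λ a b → ⇔.trans (proj₁ (chain a b)) (proj₂ (chain a b))))
    (λ (right , left) a b → right a b , ⇔.trans (⇔.sym (right a b)) (left a b))

theorem14 : ∀ {c ℓ₁ ℓ₂ : Level} (P : Pomonoid c ℓ₁ ℓ₂) →
    let open Pomonoid P in
    (¬r ¬l : Carrier → Carrier) (o : Carrier) →
    ((∀ a b → (((a ∙ b) ≤ o) ⇔ (b ≤ ¬r a)) × ((b ≤ ¬r a) ⇔ (a ≤ ¬l b)))
    ⇔
    ((∀ {a b} → a ≤ b → ¬r b ≤ ¬r a)
    × (∀ {a b} → a ≤ b → ¬l b ≤ ¬l a)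
    × (¬r ε ≤ o) × (ε ≤ ¬r o) × (∀ x y → (x ∙ ¬r (y ∙ x)) ≤ ¬r y)
    × (¬l ε ≤ o) × (ε ≤ ¬l o) × (∀ x y → (¬l (x ∙ y) ∙ x) ≤ ¬l y)))
theorem14 P ¬r ¬l o =
  ⇔.trans (residualChain⇔bothResiduals P)
    (⇔.trans (rightResidual⇔axioms P ×-⇔ leftResidual⇔axioms P) interleave)
  where
  open Pomonoid P using (ε; _∙_; _≤_)
  interleave : (RightNegationAxioms P ¬r o × LeftNegationAxioms P ¬l o) ⇔
    (Antitone P ¬r × Antitone P ¬l
    × (¬r ε ≤ o) × (ε ≤ ¬r o) × (∀ x y → (x ∙ ¬r (y ∙ x)) ≤ ¬r y)
    × (¬l ε ≤ o) × (ε ≤ ¬l o) × (∀ x y → (¬l (x ∙ y) ∙ x) ≤ ¬l y))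
  interleave = mk⇔
    (λ ((ar , r1 , r0 , rx) , (al , l1 , l0 , lx)) → ar , al , r1 , r0 , rx , l1 , l0 , lx)
    (λ (ar , al , r1 , r0 , rx , l1 , l0 , lx) → (ar , r1 , r0 , rx) , (al , l1 , l0 , lx))
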